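{- For any word $w\in B^*$ and any two constants $a,b\in B$, two distinct maximal $ab$-factors of $w$ do not overlap.
   Context: $B$ is a finite alphabet with involution $c\mapsto\overline c$ ($\overline{\overline c}=c$), extended to words by $\overline{c_1\cdots c_m}=\overline{c_m}\cdots\overline{c_1}$. The $ab$-blocks are defined as follows: (1) if $a=b$: the words $a^i$ and $\overline a^i$ for $i\ge2$; (2) if $a\ne b$, $\overline a\ne a$, $\overline b\ne b$: the words $ab$ and $\overline b\,\overline a$; (3) if $a\ne b$, $\overline a=a$, $\overline b\ne b$: the words $ab$, $\overline b a$ and $\overline b ab$; (4) if $a\ne b$, $\overline a\ne a$, $\overline b=b$: the words $ab$, $b\overline a$ and $ab\overline a$; (5) if $a\ne b$, $\overline a=a$, $\overline b=b$: the words $(ba)^i$, $a(ba)^i$, $(ba)^ib$, $(ab)^i$ for $i\ge1$. (When $\overline a=a$, $a$ and $\overline a$ are the same letter.) An occurrence of an $ab$-block in a word is an $ab$-factor; it is maximal if it is not contained in any other $ab$-factor. -}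

module Defs where

open import Data.Nat using (ℕ; zero; suc; _+_; _≤_; _<_)
open import Data.Fin using (Fin)
open import Data.List using (List; []; _∷_; _++_; replicate; take; drop; length)
open import Data.Product using (_×_; ∃-syntax)
open import Relation.Binary.PropositionalEquality using (_≡_; _≢_)

record Alphabet : Set where
  field
    size    : ℕ
    inv     : Fin size → Fin size
    inv-inv : (c : Fin size) → inv (inv c) ≡ c

module _ (A : Alphabet) where
  open Alphabet A

  B : Set
  B = Fin size

  Word : Set
  Word = List B

  rep : ℕ → Word → Word
  rep zero    u = []
  rep (suc i) u = u ++ rep i u

  data IsBlock (a b : B) : Word → Set where
    c1  : ∀ i → a ≡ b → 2 ≤ i → IsBlock a b (replicate i a)
    c1' : ∀ i → a ≡ b → 2 ≤ i → IsBlock a b (replicate i (inv a))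
    c2  : a ≢ b → inv a ≢ a → inv b ≢ b → IsBlock a b (a ∷ b ∷ [])
    c2' : a ≢ b → inv a ≢ a → inv b ≢ b → IsBlock a b (inv b ∷ inv a ∷ [])
    c3  : a ≢ b → inv a ≡ a → inv b ≢ b → IsBlock a b (a ∷ b ∷ [])
    c3' : a ≢ b → inv a ≡ a → inv b ≢ b → IsBlock a b (inv b ∷ a ∷ [])
    c3'' : a ≢ b → inv a ≡ a → inv b ≢ b → IsBlock a b (inv b ∷ a ∷ b ∷ [])
    c4  : a ≢ b → inv a ≢ a → inv b ≡ b → IsBlock a b (a ∷ b ∷ [])
    c4' : a ≢ b → inv a ≢ a → inv b ≡ b → IsBlock a b (b ∷ inv a ∷ [])
    c4'' : a ≢ b → inv a ≢ a → inv b ≡ b → IsBlock a b (a ∷ b ∷ inv a ∷ [])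
    c5a : ∀ i → a ≢ b → inv a ≡ a → inv b ≡ b → 1 ≤ i → IsBlock a b (rep i (b ∷ a ∷ []))
    c5b : ∀ i → a ≢ b → inv a ≡ a → inv b ≡ b → 1 ≤ i → IsBlock a b (a ∷ rep i (b ∷ a ∷ []))
    c5c : ∀ i → a ≢ b → inv a ≡ a → inv b ≡ b → 1 ≤ i → IsBlock a b (rep i (b ∷ a ∷ []) ++ (b ∷ []))
    c5d : ∀ i → a ≢ b → inv a ≡ a → inv b ≡ b → 1 ≤ i → IsBlock a b (rep i (a ∷ b ∷ []))

  -- The factor of w starting at position i (0-based) of length l.
  factor : Word → ℕ → ℕ → Word
  factor w i l = take l (drop i w)

  -- An occurrence (i , l) of an ab-block in w: an ab-factor.
  IsFactor : B → B → Word → ℕ → ℕ → Set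
  IsFactor a b w i l = (i + l ≤ length w) × IsBlock a b (factor w i l)

  _,_⊑_,_ : ℕ → ℕ → ℕ → ℕ → Set
  i , l ⊑ j , m = (j ≤ i) × (i + l ≤ j + m)

  IsMaximalFactor : B → B → Word → ℕ → ℕ → Set
  IsMaximalFactor a b w i l =
    IsFactor a b w i l ×
    (∀ j m → IsFactor a b w j m → i , l ⊑ j , m → (j ≡ i) × (m ≡ l))

  Overlap : ℕ → ℕ → ℕ → ℕ → Set
  Overlap i l j m = ∃[ p ] ((i ≤ p) × (p < i + l) × (j ≤ p) × (p < j + m))

-- Call a pair of letters (x , y) an ab-link when x y is "a b" or "b̄ ā".
-- The key observation is that the ab-blocks are exactly the words of
-- length at least 2 all of whose consecutive letter pairs are ab-links,
-- i.e. the words of length ≥ 2 that are 'Linked' by the ab-link relation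
-- (block⇒linked, block⇒length, linked⇒block).  Being linked is a local
-- property, so two overlapping linked windows of a word glue to a linked
-- window covering both (linked-union, a general fact about lists).  Consequently the union
-- of two overlapping ab-factors is again an ab-factor (union-factor).
--
-- The theorem follows: given overlapping maximal factors (i , l) and
-- (j , m) with i ≤ j, either (j , m) lies inside (i , l), and maximality
-- of (j , m) makes them equal, or it sticks out to the right, and then
-- their union is a strictly larger factor containing (i , l),
-- contradicting maximality of (i , l) (ordered-overlap-coincide).  The
-- case j ≤ i is symmetric (overlap-coincide).
module Submission where

open import Defs
open import Data.Nat using (ℕ; zero; suc; _+_; _≤_; _<_; z≤n; s≤s; _≤?_)
open import Data.Nat.Properties
  using (≤-refl; ≤-trans; <⇒≤; <-irrefl; ≤-total; ≰⇒>; +-assoc; +-monoʳ-≤; +-cancelˡ-<; ⊓-monoˡ-≤; m≤n⇒∃[o]m+o≡n)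
open import Data.Fin.Properties using (_≟_)
open import Data.List using (List; []; _∷_; _++_; replicate; take; drop; length; head)
open import Data.List.Properties using (length-replicate; length-take; drop-drop)
open import Data.List.Relation.Unary.Linked using (Linked; []; [-]; _∷_; head′; tail; _∷′_)
open import Data.Maybe using (just)
open import Data.Maybe.Relation.Binary.Connected using (Connected; just-nothing)
open import Data.Product using (_×_; _,_; proj₂; ∃-syntax)
open import Data.Sum using (_⊎_; inj₁; inj₂)
open import Data.Empty using (⊥-elim)
open import Level using (Level)
open import Relation.Binary.Core using (Rel)
open import Relation.Binary.PropositionalEquality
open import Relation.Nullary using (¬_; yes; no)

-- If the window of length l at position 0 and the
-- window of length m at position d < l are R-linked, so is the window of
-- length d + m at position 0: every adjacent pair of the latter lies in
-- one of the two former windows.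
module _ {c ℓ : Level} {X : Set c} {R : Rel X ℓ} where

  link-to-prefix : ∀ {x} (v : List X) n k →
    Connected R (just x) (head (take (suc n) v)) →
    Connected R (just x) (head (take k v))
  link-to-prefix v       n zero    _ = just-nothing
  link-to-prefix []      n (suc k) _ = just-nothing
  link-to-prefix (y ∷ v) n (suc k) xy = xy

  linked-union : (v : List X) (d : ℕ) {l : ℕ} (m : ℕ) → d < l →
    Linked R (take l v) → Linked R (take m (drop d v)) →
    Linked R (take (d + m) v)
  linked-union v       zero    m _ _ linked₂ = linked₂
  linked-union []      (suc d) m _ _ _       = []
  linked-union (x ∷ v) (suc d) {suc (suc l)} m (s≤s d<l) linked₁ linked₂ =
    link-to-prefix v l (d + m) (head′ linked₁)
      ∷′ linked-union v d m d<l (tail linked₁) linked₂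

length-take-mono : ∀ {c} {X : Set c} {l n} (v : List X) → l ≤ n → length (take l v) ≤ length (take n v)
length-take-mono {l = l} {n} v l≤n =
  subst₂ _≤_ (sym (length-take l v)) (sym (length-take n v)) (⊓-monoˡ-≤ (length v) l≤n)

rep-shift : ∀ {A : Alphabet} i (x y : B A) → rep A i (x ∷ y ∷ []) ++ x ∷ [] ≡ x ∷ rep A i (y ∷ x ∷ [])
rep-shift zero    x y = refl
rep-shift (suc i) x y = cong (λ u → x ∷ y ∷ u) (rep-shift i x y)

module Blocks (A : Alphabet) (a b : B A) where
  open Alphabet A

  inv-injective : ∀ {x y} → inv x ≡ inv y → x ≡ y
  inv-injective {x} {y} e = trans (sym (inv-inv x)) (trans (cong inv e) (inv-inv y))

  Link : B A → B A → Set
  Link x y = (x ≡ a × y ≡ b) ⊎ (x ≡ inv b × y ≡ inv a)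

  Linked-ab : Word A → Set
  Linked-ab = Linked Link

  linked-replicate : ∀ {x} → Link x x → ∀ i → Linked-ab (replicate i x)
  linked-replicate xx zero                = []
  linked-replicate xx (suc zero)          = [-]
  linked-replicate xx (suc (suc i))       = xx ∷ linked-replicate xx (suc i)

  module Alternating {x y} (xy : Link x y) (yx : Link y x) where
    mutual
      linked-rep : ∀ i → Linked-ab (rep A i (x ∷ y ∷ []))
      linked-rep zero    = []
      linked-rep (suc i) = xy ∷ linked-y-rep i

      linked-y-rep : ∀ i → Linked-ab (y ∷ rep A i (x ∷ y ∷ []))
      linked-y-rep zero    = [-]
      linked-y-rep (suc i) = yx ∷ linked-rep (suc i)

  block⇒linked : ∀ {u} → IsBlock A a b u → Linked-ab u
  block⇒linked (c1 i a≡b _)     = linked-replicate (inj₁ (refl , a≡b)) i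
  block⇒linked (c1' i a≡b _)    = linked-replicate (inj₂ (cong inv a≡b , refl)) i
  block⇒linked (c2 _ _ _)       = inj₁ (refl , refl) ∷ [-]
  block⇒linked (c2' _ _ _)      = inj₂ (refl , refl) ∷ [-]
  block⇒linked (c3 _ _ _)       = inj₁ (refl , refl) ∷ [-]
  block⇒linked (c3' _ ā≡a _)    = inj₂ (refl , sym ā≡a) ∷ [-]
  block⇒linked (c3'' _ ā≡a _)   = inj₂ (refl , sym ā≡a) ∷ inj₁ (refl , refl) ∷ [-]
  block⇒linked (c4 _ _ _)       = inj₁ (refl , refl) ∷ [-]
  block⇒linked (c4' _ _ b̄≡b)    = inj₂ (sym b̄≡b , refl) ∷ [-]
  block⇒linked (c4'' _ _ b̄≡b)   = inj₁ (refl , refl) ∷ inj₂ (sym b̄≡b , refl) ∷ [-]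
  block⇒linked (c5a i _ ā≡a b̄≡b _) =
    Alternating.linked-rep (inj₂ (sym b̄≡b , sym ā≡a)) (inj₁ (refl , refl)) i
  block⇒linked (c5b i _ ā≡a b̄≡b _) =
    Alternating.linked-y-rep (inj₂ (sym b̄≡b , sym ā≡a)) (inj₁ (refl , refl)) i
  block⇒linked (c5c i _ ā≡a b̄≡b _) =
    subst Linked-ab (sym (rep-shift i b a))
      (Alternating.linked-y-rep (inj₁ (refl , refl)) (inj₂ (sym b̄≡b , sym ā≡a)) i)
  block⇒linked (c5d i _ ā≡a b̄≡b _) =
    Alternating.linked-rep (inj₁ (refl , refl)) (inj₂ (sym b̄≡b , sym ā≡a)) i

  block⇒length : ∀ {u} → IsBlock A a b u → 2 ≤ length u
  block⇒length (c1 i _ 2≤i)          = subst (2 ≤_) (sym (length-replicate i)) 2≤i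
  block⇒length (c1' i _ 2≤i)         = subst (2 ≤_) (sym (length-replicate i)) 2≤i
  block⇒length (c2 _ _ _)            = s≤s (s≤s z≤n)
  block⇒length (c2' _ _ _)           = s≤s (s≤s z≤n)
  block⇒length (c3 _ _ _)            = s≤s (s≤s z≤n)
  block⇒length (c3' _ _ _)           = s≤s (s≤s z≤n)
  block⇒length (c3'' _ _ _)          = s≤s (s≤s z≤n)
  block⇒length (c4 _ _ _)            = s≤s (s≤s z≤n)
  block⇒length (c4' _ _ _)           = s≤s (s≤s z≤n)
  block⇒length (c4'' _ _ _)          = s≤s (s≤s z≤n)
  block⇒length (c5a (suc i) _ _ _ _) = s≤s (s≤s z≤n)
  block⇒length (c5b (suc i) _ _ _ _) = s≤s (s≤s z≤n)
  block⇒length (c5c (suc i) _ _ _ _) = s≤s (s≤s z≤n)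
  block⇒length (c5d (suc i) _ _ _ _) = s≤s (s≤s z≤n)

  -- Case (1), a = b: links join equal letters, so linked words are constant.
  link-equal : a ≡ b → ∀ {x y} → Link x y → x ≡ y
  link-equal a≡b (inj₁ (x≡a , y≡b)) = trans x≡a (trans a≡b (sym y≡b))
  link-equal a≡b (inj₂ (x≡b̄ , y≡ā)) = trans x≡b̄ (trans (cong inv (sym a≡b)) (sym y≡ā))

  linked-constant : a ≡ b → ∀ {x} r → Linked-ab (x ∷ r) → x ∷ r ≡ replicate (suc (length r)) x
  linked-constant a≡b         []      [-]          = refl
  linked-constant a≡b {x} (y ∷ r) (xy ∷ linked) =
    cong (x ∷_) (trans (linked-constant a≡b r linked)
                       (cong (replicate (suc (length r))) (sym (link-equal a≡b xy))))

  linked⇒block₁ : a ≡ b → ∀ x y r → Linked-ab (x ∷ y ∷ r) → IsBlock A a b (x ∷ y ∷ r)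
  linked⇒block₁ a≡b x y r linked@(inj₁ (refl , _) ∷ _) =
    subst (IsBlock A a b) (sym (linked-constant a≡b (y ∷ r) linked)) (c1 _ a≡b (s≤s (s≤s z≤n)))
  linked⇒block₁ a≡b x y r linked@(inj₂ (refl , _) ∷ _) =
    subst (IsBlock A a b)
      (sym (trans (linked-constant a≡b (y ∷ r) linked) (cong (replicate _) (cong inv (sym a≡b)))))
      (c1' _ a≡b (s≤s (s≤s z≤n)))

  -- Case (2): no link can follow another, so only ab and b̄ā remain.
  linked⇒block₂ : a ≢ b → inv a ≢ a → inv b ≢ b →
    ∀ x y r → Linked-ab (x ∷ y ∷ r) → IsBlock A a b (x ∷ y ∷ r)
  linked⇒block₂ a≢b ā≢a b̄≢b x y [] (inj₁ (refl , refl) ∷ _) = c2 a≢b ā≢a b̄≢b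
  linked⇒block₂ a≢b ā≢a b̄≢b x y [] (inj₂ (refl , refl) ∷ _) = c2' a≢b ā≢a b̄≢b
  linked⇒block₂ a≢b ā≢a b̄≢b x y (z ∷ r) (inj₁ (refl , refl) ∷ inj₁ (b≡a , _) ∷ _) = ⊥-elim (a≢b (sym b≡a))
  linked⇒block₂ a≢b ā≢a b̄≢b x y (z ∷ r) (inj₁ (refl , refl) ∷ inj₂ (b≡b̄ , _) ∷ _) = ⊥-elim (b̄≢b (sym b≡b̄))
  linked⇒block₂ a≢b ā≢a b̄≢b x y (z ∷ r) (inj₂ (refl , refl) ∷ inj₁ (ā≡a , _) ∷ _) = ⊥-elim (ā≢a ā≡a)
  linked⇒block₂ a≢b ā≢a b̄≢b x y (z ∷ r) (inj₂ (refl , refl) ∷ inj₂ (ā≡b̄ , _) ∷ _) = ⊥-elim (a≢b (inv-injective ā≡b̄))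

  -- Case (3), ā = a: only b̄a may be followed by a link, namely ab.
  linked⇒block₃ : a ≢ b → inv a ≡ a → inv b ≢ b →
    ∀ x y r → Linked-ab (x ∷ y ∷ r) → IsBlock A a b (x ∷ y ∷ r)
  linked⇒block₃ a≢b ā≡a b̄≢b x y [] (inj₁ (refl , refl) ∷ _) = c3 a≢b ā≡a b̄≢b
  linked⇒block₃ a≢b ā≡a b̄≢b x y [] (inj₂ (refl , refl) ∷ _) =
    subst (λ c → IsBlock A a b (inv b ∷ c ∷ [])) (sym ā≡a) (c3' a≢b ā≡a b̄≢b)
  linked⇒block₃ a≢b ā≡a b̄≢b x y (z ∷ r) (inj₁ (refl , refl) ∷ inj₁ (b≡a , _) ∷ _) = ⊥-elim (a≢b (sym b≡a))
  linked⇒block₃ a≢b ā≡a b̄≢b x y (z ∷ r) (inj₁ (refl , refl) ∷ inj₂ (b≡b̄ , _) ∷ _) = ⊥-elim (b̄≢b (sym b≡b̄))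
  linked⇒block₃ a≢b ā≡a b̄≢b x y (z ∷ r) (inj₂ (refl , refl) ∷ inj₂ (ā≡b̄ , _) ∷ _) = ⊥-elim (a≢b (inv-injective ā≡b̄))
  linked⇒block₃ a≢b ā≡a b̄≢b x y (z ∷ []) (inj₂ (refl , refl) ∷ inj₁ (_ , refl) ∷ _) =
    subst (λ c → IsBlock A a b (inv b ∷ c ∷ b ∷ [])) (sym ā≡a) (c3'' a≢b ā≡a b̄≢b)
  linked⇒block₃ a≢b ā≡a b̄≢b x y (z ∷ t ∷ r) (inj₂ (refl , refl) ∷ inj₁ (_ , refl) ∷ inj₁ (b≡a , _) ∷ _) =
    ⊥-elim (a≢b (sym b≡a))
  linked⇒block₃ a≢b ā≡a b̄≢b x y (z ∷ t ∷ r) (inj₂ (refl , refl) ∷ inj₁ (_ , refl) ∷ inj₂ (b≡b̄ , _) ∷ _) =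
    ⊥-elim (b̄≢b (sym b≡b̄))

  -- Case (4), b̄ = b: only ab may be followed by a link, namely bā.
  linked⇒block₄ : a ≢ b → inv a ≢ a → inv b ≡ b →
    ∀ x y r → Linked-ab (x ∷ y ∷ r) → IsBlock A a b (x ∷ y ∷ r)
  linked⇒block₄ a≢b ā≢a b̄≡b x y [] (inj₁ (refl , refl) ∷ _) = c4 a≢b ā≢a b̄≡b
  linked⇒block₄ a≢b ā≢a b̄≡b x y [] (inj₂ (refl , refl) ∷ _) =
    subst (λ c → IsBlock A a b (c ∷ inv a ∷ [])) (sym b̄≡b) (c4' a≢b ā≢a b̄≡b)
  linked⇒block₄ a≢b ā≢a b̄≡b x y (z ∷ r) (inj₂ (refl , refl) ∷ inj₁ (ā≡a , _) ∷ _) = ⊥-elim (ā≢a ā≡a)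
  linked⇒block₄ a≢b ā≢a b̄≡b x y (z ∷ r) (inj₂ (refl , refl) ∷ inj₂ (ā≡b̄ , _) ∷ _) = ⊥-elim (a≢b (inv-injective ā≡b̄))
  linked⇒block₄ a≢b ā≢a b̄≡b x y (z ∷ r) (inj₁ (refl , refl) ∷ inj₁ (b≡a , _) ∷ _) = ⊥-elim (a≢b (sym b≡a))
  linked⇒block₄ a≢b ā≢a b̄≡b x y (z ∷ []) (inj₁ (refl , refl) ∷ inj₂ (_ , refl) ∷ _) = c4'' a≢b ā≢a b̄≡b
  linked⇒block₄ a≢b ā≢a b̄≡b x y (z ∷ t ∷ r) (inj₁ (refl , refl) ∷ inj₂ (_ , refl) ∷ inj₁ (ā≡a , _) ∷ _) =
    ⊥-elim (ā≢a ā≡a)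
  linked⇒block₄ a≢b ā≢a b̄≡b x y (z ∷ t ∷ r) (inj₁ (refl , refl) ∷ inj₂ (_ , refl) ∷ inj₂ (ā≡b̄ , _) ∷ _) =
    ⊥-elim (a≢b (inv-injective ā≡b̄))

  -- Case (5), ā = a and b̄ = b: the links are ab and ba, so linked words
  -- alternate between a and b; classify them by first letter and parity.
  module SelfInverse (a≢b : a ≢ b) (ā≡a : inv a ≡ a) (b̄≡b : inv b ≡ b) where
    after-a : ∀ {y} → Link a y → y ≡ b
    after-a (inj₁ (_ , y≡b))  = y≡b
    after-a (inj₂ (a≡b̄ , _)) = ⊥-elim (a≢b (trans a≡b̄ b̄≡b))

    after-b : ∀ {y} → Link b y → y ≡ a
    after-b (inj₁ (b≡a , _))  = ⊥-elim (a≢b (sym b≡a))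
    after-b (inj₂ (_ , y≡ā)) = trans y≡ā ā≡a

    mutual
      from-a : ∀ r → Linked-ab (a ∷ r) → ∃[ i ]
        (a ∷ r ≡ rep A (suc i) (a ∷ b ∷ []) ⊎ a ∷ r ≡ a ∷ rep A i (b ∷ a ∷ []))
      from-a [] _ = 0 , inj₂ refl
      from-a (y ∷ r) (ay ∷ linked) with after-a ay
      ... | refl with from-b r linked
      ...   | i , inj₁ even = suc i , inj₂ (cong (a ∷_) even)
      ...   | i , inj₂ odd  = i , inj₁ (cong (a ∷_) (trans odd (rep-shift i b a)))

      from-b : ∀ r → Linked-ab (b ∷ r) → ∃[ i ]
        (b ∷ r ≡ rep A (suc i) (b ∷ a ∷ []) ⊎ b ∷ r ≡ rep A i (b ∷ a ∷ []) ++ b ∷ [])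
      from-b [] _ = 0 , inj₂ refl
      from-b (y ∷ r) (by ∷ linked) with after-b by
      ... | refl with from-a r linked
      ...   | i , inj₁ even = suc i , inj₂ (trans (cong (b ∷_) even) (sym (rep-shift (suc i) b a)))
      ...   | i , inj₂ odd  = i , inj₁ (cong (b ∷_) odd)

    linked⇒block-b : ∀ y r → Linked-ab (b ∷ y ∷ r) → IsBlock A a b (b ∷ y ∷ r)
    linked⇒block-b y r linked with from-b (y ∷ r) linked
    ... | i     , inj₁ even = subst (IsBlock A a b) (sym even) (c5a (suc i) a≢b ā≡a b̄≡b (s≤s z≤n))
    ... | suc i , inj₂ odd  = subst (IsBlock A a b) (sym odd) (c5c (suc i) a≢b ā≡a b̄≡b (s≤s z≤n))

    linked⇒block₅ : ∀ x y r → Linked-ab (x ∷ y ∷ r) → IsBlock A a b (x ∷ y ∷ r)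
    linked⇒block₅ x y r linked@(inj₁ (refl , _) ∷ _) with from-a (y ∷ r) linked
    ... | i     , inj₁ even = subst (IsBlock A a b) (sym even) (c5d (suc i) a≢b ā≡a b̄≡b (s≤s z≤n))
    ... | suc i , inj₂ odd  = subst (IsBlock A a b) (sym odd) (c5b (suc i) a≢b ā≡a b̄≡b (s≤s z≤n))
    linked⇒block₅ x y r linked@(inj₂ (refl , _) ∷ _) =
      subst (λ c → IsBlock A a b (c ∷ y ∷ r)) (sym b̄≡b)
        (linked⇒block-b y r (subst (λ c → Linked-ab (c ∷ y ∷ r)) b̄≡b linked))

  linked⇒block : ∀ u → 2 ≤ length u → Linked-ab u → IsBlock A a b u
  linked⇒block (x ∷ []) (s≤s ()) _
  linked⇒block (x ∷ y ∷ r) _ linked with a ≟ b | inv a ≟ a | inv b ≟ b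
  ... | yes a≡b | _       | _       = linked⇒block₁ a≡b x y r linked
  ... | no a≢b  | no ā≢a  | no b̄≢b  = linked⇒block₂ a≢b ā≢a b̄≢b x y r linked
  ... | no a≢b  | yes ā≡a | no b̄≢b  = linked⇒block₃ a≢b ā≡a b̄≢b x y r linked
  ... | no a≢b  | no ā≢a  | yes b̄≡b = linked⇒block₄ a≢b ā≢a b̄≡b x y r linked
  ... | no a≢b  | yes ā≡a | yes b̄≡b = SelfInverse.linked⇒block₅ a≢b ā≡a b̄≡b x y r linked

  union-factor : ∀ w i d {l} m → d < l → l ≤ d + m →
    IsFactor A a b w i l → IsFactor A a b w (i + d) m → IsFactor A a b w i (d + m)
  union-factor w i d {l} m d<l l≤d+m (_ , block₁) (fits₂ , block₂) =
    subst (_≤ length w) (+-assoc i d m) fits₂ , linked⇒block _ long linked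
    where
    long : 2 ≤ length (factor A w i (d + m))
    long = ≤-trans (block⇒length block₁) (length-take-mono (drop i w) l≤d+m)
    linked : Linked-ab (factor A w i (d + m))
    linked = linked-union (drop i w) d m d<l (block⇒linked block₁)
               (subst (λ v → Linked-ab (take m v)) (sym (drop-drop i d w)) (block⇒linked block₂))

  ordered-overlap-coincide : ∀ w {i l j m} → i ≤ j →
    IsMaximalFactor A a b w i l → IsMaximalFactor A a b w j m →
    Overlap A i l j m → (i ≡ j) × (l ≡ m)
  ordered-overlap-coincide w {i} {l} {j} {m} i≤j (F₁ , maximal₁) (F₂ , maximal₂) (_ , _ , p<i+l , j≤p , _)
    with m≤n⇒∃[o]m+o≡n i≤j
  ... | d , refl with j + m ≤? i + l
  ...   | yes inside = maximal₂ i l F₁ (i≤j , inside)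
  ...   | no outside = ⊥-elim (<-irrefl (sym d+m≡l) l<d+m)
    where
    d<l : d < l
    d<l = +-cancelˡ-< i d l (≤-trans (s≤s j≤p) p<i+l)
    l<d+m : l < d + m
    l<d+m = +-cancelˡ-< i l (d + m) (subst (i + l <_) (+-assoc i d m) (≰⇒> outside))
    l≤d+m : l ≤ d + m
    l≤d+m = <⇒≤ l<d+m
    union : IsFactor A a b w i (d + m)
    union = union-factor w i d m d<l l≤d+m F₁ F₂
    d+m≡l : d + m ≡ l
    d+m≡l = proj₂ (maximal₁ i (d + m) union (≤-refl , +-monoʳ-≤ i l≤d+m))

  overlap-coincide : ∀ w {i l j m} →
    IsMaximalFactor A a b w i l → IsMaximalFactor A a b w j m →
    Overlap A i l j m → (i ≡ j) × (l ≡ m)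
  overlap-coincide w {i} {l} {j} {m} maximal₁ maximal₂ overlaps with ≤-total i j
  ... | inj₁ i≤j = ordered-overlap-coincide w i≤j maximal₁ maximal₂ overlaps
  ... | inj₂ j≤i = swap (ordered-overlap-coincide w j≤i maximal₂ maximal₁ (flip overlaps))
    where
    swap : (j ≡ i) × (m ≡ l) → (i ≡ j) × (l ≡ m)
    swap (j≡i , m≡l) = sym j≡i , sym m≡l
    flip : Overlap A i l j m → Overlap A j m i l
    flip (q , i≤q , q<i+l , j≤q , q<j+m) = q , j≤q , q<j+m , i≤q , q<i+l

mainTheorem6 : (A : Alphabet) (w : Word A) (a b : B A) (i l j m : ℕ) →
    IsMaximalFactor A a b w i l → IsMaximalFactor A a b w j m →
    ¬ ((i ≡ j) × (l ≡ m)) → ¬ Overlap A i l j m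
mainTheorem6 A w a b i l j m maximal₁ maximal₂ distinct overlaps =
  distinct (Blocks.overlap-coincide A a b w maximal₁ maximal₂ overlaps)
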